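{- For all integers $n \geq 2$, $\mathsf{sr}(n) - 1 = \mathrm{length}(\mathsf{Tchouk}_{n-1}) = \mathrm{final}(\mathsf{Tchouk}_{n-1})$, where for a configuration $c$, $\mathrm{length}(c)$ is the largest index $i$ with $c_i \neq 0$ and $\mathrm{final}(c)$ is the value of that $c_i$.
   Context: For $n \in \{1,2,\ldots\}$, $\mathsf{Alist}_n$ is the sequence of integer pairs produced as follows: begin with $\langle 1, n\rangle$. Given the current pair $\langle i, y_i\rangle$ with $y_i > i$, the next pair is $\langle i+1, y_{i+1}\rangle$, where $y_{i+1}$ is the smallest integer with $(i+1)y_{i+1} > i(y_i+1)$. Stop when the current pair $\langle i,y_i\rangle$ satisfies $y_i \leq i$. This process always terminates; its final pair is denoted $\langle \mathsf{sr}(n), y_{\mathsf{sr}(n)}\rangle$, and $\mathsf{sr}(n)$ is called the strange root of $n$. Tchoukaillon solitaire: a board consists of a pit (hole $0$) followed by holes $1,2,3,\ldots$; a configuration $c=(c_1,c_2,\ldots)$ records the number $c_i$ of stones in hole $i$. A move selects a hole $i$ containing $s_i$ stones, removes them, and puts one stone in each of holes $i-1,\ldots,i-s_i$ (illegal if $s_i>i$). The game is won if all stones reach the pit. For each $n\ge0$ there is a unique winning configuration with $n$ stones, denoted $\mathsf{Tchouk}_n$; explicitly, for $n\geq 1$, $\mathsf{Tchouk}_n = (c_1,\ldots,c_\ell)$ where $c_1 = n \bmod 2$ and $c_k = \bigl(n-(c_1+\cdots+c_{k-1})\bigr) \bmod (k+1)$, stopping at the first $\ell$ with $c_1+\cdots+c_\ell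 = n$. -}

module Defs where

open import Data.Nat using (ℕ; zero; suc; _+_; _*_; _∸_; _≤_; _<_; _>_; _%_)
open import Data.Nat.Properties using (_≟_)
open import Data.List using (List; []; _∷_)
open import Data.Product using (Σ; _×_; _,_)
open import Relation.Nullary using (yes; no)

-- AlistPair n i y  :  ⟨ i , y ⟩ occurs in Alist_n.
-- Start with ⟨1,n⟩; from ⟨i,y⟩ with y > i go to ⟨i+1,y'⟩ where y' is the
-- smallest integer with (i+1) y' > i (y+1).  (That smallest integer is
-- positive, so ranging over ℕ is equivalent to ranging over ℤ.)

data AlistPair (n : ℕ) : ℕ → ℕ → Set where
  start : AlistPair n 1 n
  step  : ∀ {i y y'} → AlistPair n i y → i < y →
          suc i * y' > i * (y + 1) →
          (∀ z → suc i * z > i * (y + 1) → y' ≤ z) →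
          AlistPair n (suc i) y'

-- IsSr n s : s is the strange root of n, i.e. the final pair of Alist_n
-- is ⟨ s , y ⟩ for some y ≤ s (the process stops at the first such pair).
IsSr : ℕ → ℕ → Set
IsSr n s = Σ ℕ (λ y → AlistPair n s y × y ≤ s)

-- Tchoukaillon configurations, as lists (c_1, c_2, ..., c_ℓ).

tchoukFrom : ℕ → ℕ → ℕ → List ℕ
tchoukFrom zero       k r       = []
tchoukFrom (suc fuel) k zero    = []
tchoukFrom (suc fuel) k (suc r) =
  let c = suc r % suc k in c ∷ tchoukFrom fuel (suc k) (suc r ∸ c)

-- Tchouk_n.  Fuel suc n suffices: at hole k ≥ n the remaining count is
-- < k+1, so the process ends by hole n.
Tchouk : ℕ → List ℕ
Tchouk n = tchoukFrom (suc n) 1 n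

-- length(c): largest index i (1-based) with c_i ≠ 0 (0 if none);
-- final(c): the value of that c_i (0 if none).
private
  lastNZ : ℕ → List ℕ → ℕ × ℕ → ℕ × ℕ
  lastNZ i []       acc = acc
  lastNZ i (c ∷ cs) acc with c ≟ 0
  ... | yes _ = lastNZ (suc i) cs acc
  ... | no  _ = lastNZ (suc i) cs (i , c)

lengthC : List ℕ → ℕ
lengthC cs with lastNZ 1 cs (0 , 0)
... | (l , _) = l

finalC : List ℕ → ℕ
finalC cs with lastNZ 1 cs (0 , 0)
... | (_ , f) = f

-- Write K for a hole and q + K for the entry of Alist_n at index K.  While
-- Tchouk_{n-1} is laid out, exactly q K stones remain for holes K, K + 1, …
-- (initially K = 1, q = n - 1).  Dividing q K = r + q' (K + 1) with r ≤ K,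
-- hole K receives r stones, (K + 1) q' stones remain, and the next pair of
-- Alist_n is ⟨K + 1, q' + K + 1⟩, so the invariant persists.  Since q' < q,
-- the excess eventually vanishes; then q K = r ≤ K forces q = 1, so hole K
-- is the last nonempty hole and holds K stones, while ⟨K + 1, K + 1⟩ ends
-- Alist_n, i.e. sr(n) = K + 1.
module Submission where

open import Defs
open import Data.Nat
open import Data.Nat.Properties
open import Data.Nat.DivMod
open import Data.Nat.Divisibility using (n∣m*n)
open import Data.Nat.Solver using (module +-*-Solver)
open import Data.List using (List; []; _∷_)
open import Data.Product using (Σ; ∃; _×_; _,_; proj₁; proj₂)
open import Relation.Binary.PropositionalEquality

open +-*-Solver using (solve; _:+_; _:*_; con; _:=_)

m<n*[1+m/n] : ∀ m n .{{_ : NonZero n}} → m < n * suc (m / n)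
m<n*[1+m/n] m n = begin-strict
  m                     ≡⟨ m≡m%n+[m/n]*n m n ⟩
  m % n + (m / n) * n   <⟨ +-monoˡ-< ((m / n) * n) (m%n<n m n) ⟩
  suc (m / n) * n       ≡⟨ *-comm (suc (m / n)) n ⟩
  n * suc (m / n)       ∎
  where open ≤-Reasoning

m<n*o⇒m/n<o : ∀ m n .{{_ : NonZero n}} o → m < n * o → m / n < o
m<n*o⇒m/n<o m n o m<no = m<n*o⇒m/o<n (subst (m <_) (*-comm n o) m<no)

alistPair-step : ∀ {n i y} → AlistPair n i y → i < y → AlistPair n (suc i) (suc (i * (y + 1) / suc i))
alistPair-step {i = i} {y} p i<y =
  step p i<y (m<n*[1+m/n] (i * (y + 1)) (suc i)) (m<n*o⇒m/n<o (i * (y + 1)) (suc i))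

next-excess : ∀ K q → suc (K * ((q + K) + 1) / suc K) ≡ q * K / suc K + suc K
next-excess K q = begin
  suc (K * ((q + K) + 1) / suc K)         ≡⟨ cong (λ m → suc (m / suc K)) (split K q) ⟩
  suc ((q * K + K * suc K) / suc K)       ≡⟨ cong suc (+-distrib-/-∣ʳ (q * K) (n∣m*n K)) ⟩
  suc (q * K / suc K + K * suc K / suc K) ≡⟨ cong (λ k → suc (q * K / suc K + k)) (m*n/n≡m K (suc K)) ⟩
  suc (q * K / suc K + K)                 ≡⟨ +-suc (q * K / suc K) K ⟨
  q * K / suc K + suc K                   ∎
  where
  open ≡-Reasoning
  split : ∀ K q → K * ((q + K) + 1) ≡ q * K + K * suc K
  split = solve 2 (λ K q → K :* ((q :+ K) :+ con 1) := q :* K :+ K :* (con 1 :+ K)) refl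

alistPair-next-excess : ∀ {n K q} → AlistPair n K (q + K) → 0 < q →
                        AlistPair n (suc K) (q * K / suc K + suc K)
alistPair-next-excess {n} {K} {q} p 0<q =
  subst (AlistPair n (suc K)) (next-excess K q) (alistPair-step p (m<n+m K 0<q))

m*n/[1+n]≡0⇒m*n%[1+n]≡n : ∀ m n → 0 < m → m * n / suc n ≡ 0 → m * n % suc n ≡ n
m*n/[1+n]≡0⇒m*n%[1+n]≡n m n 0<m quotient≡0 = trans (m<n⇒m%n≡m mn<1+n) mn≡n
  where
  mn<1+n : m * n < suc n
  mn<1+n = m/n≡0⇒m<n quotient≡0
  mn≡n : m * n ≡ n
  mn≡n = ≤-antisym (≤-pred mn<1+n) (subst (_≤ m * n) (*-identityˡ n) (*-monoˡ-≤ n 0<m))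

m*n/[1+n]<m : ∀ m n .{{_ : NonZero m}} → m * n / suc n < m
m*n/[1+n]<m m n = m<n*o⇒m/o<n (*-monoʳ-< m (n<1+n n))

tchoukFrom-zero : ∀ f k → tchoukFrom f k 0 ≡ []
tchoukFrom-zero zero    k = refl
tchoukFrom-zero (suc f) k = refl

tchoukFrom-suc : ∀ f k m .{{_ : NonZero m}} →
                 tchoukFrom (suc f) k m ≡ m % suc k ∷ tchoukFrom f (suc k) (m / suc k * suc k)
tchoukFrom-suc f k m@(suc _) = cong (λ r → m % suc k ∷ tchoukFrom f (suc k) r) remaining
  where
  remaining : m ∸ m % suc k ≡ m / suc k * suc k
  remaining = begin
    m ∸ m % suc k                   ≡⟨ cong (m ∸_) (m%n≡m∸m/n*n m (suc k)) ⟩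
    m ∸ (m ∸ m / suc k * suc k)     ≡⟨ m∸[m∸n]≡n (m/n*n≤m m (suc k)) ⟩
    m / suc k * suc k               ∎
    where open ≡-Reasoning

lastNonZero : ℕ → List ℕ → ℕ × ℕ → ℕ × ℕ
lastNonZero i []           acc = acc
lastNonZero i (zero ∷ cs)  acc = lastNonZero (suc i) cs acc
lastNonZero i (suc c ∷ cs) acc = lastNonZero (suc i) cs (i , suc c)

lastNonZero-∷ : ∀ i c cs acc → ∃ λ acc′ → lastNonZero i (c ∷ cs) acc ≡ lastNonZero (suc i) cs acc′
lastNonZero-∷ i zero    cs acc = acc , refl
lastNonZero-∷ i (suc c) cs acc = (i , suc c) , refl

lastNonZero-unique : (F : ℕ → List ℕ → ℕ × ℕ → ℕ × ℕ) →
  (∀ i acc → F i [] acc ≡ acc) →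
  (∀ i cs acc → F i (0 ∷ cs) acc ≡ F (suc i) cs acc) →
  (∀ i c cs acc → F i (suc c ∷ cs) acc ≡ F (suc i) cs (i , suc c)) →
  ∀ i cs acc → F i cs acc ≡ lastNonZero i cs acc
lastNonZero-unique F nil zer pos i [] acc = nil i acc
lastNonZero-unique F nil zer pos i (zero ∷ cs) acc =
  trans (zer i cs acc) (lastNonZero-unique F nil zer pos (suc i) cs acc)
lastNonZero-unique F nil zer pos i (suc c ∷ cs) acc =
  trans (pos i c cs acc) (lastNonZero-unique F nil zer pos (suc i) cs (i , suc c))

-- The scan behind lengthC and finalC is private to Defs.  It is obtained as
-- the solution of the meta below: the with-abstraction turns its call into
-- a higher-order pattern in i, cs and acc.
mutual
  scanOfDefs : ℕ → List ℕ → ℕ × ℕ → ℕ × ℕ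
  scanOfDefs = _

  lengthC-finalC-scanOfDefs : ∀ cs → (lengthC cs , finalC cs) ≡ scanOfDefs 1 cs (0 , 0)
  lengthC-finalC-scanOfDefs cs with 1 | 0
  ... | i | z with (z , z)
  ... | acc = refl

lengthC-finalC : ∀ cs → (lengthC cs , finalC cs) ≡ lastNonZero 1 cs (0 , 0)
lengthC-finalC cs = trans (lengthC-finalC-scanOfDefs cs)
  (lastNonZero-unique scanOfDefs (λ _ _ → refl) (λ _ _ _ → refl) (λ _ _ _ _ → refl) 1 cs (0 , 0))

tchoukFrom-lastNonZero : ∀ {n} f k q → 0 < q → q ≤ f → AlistPair n (suc k) (q + suc k) →
  Σ ℕ λ L → IsSr n (suc L) × (∀ acc → lastNonZero (suc k) (tchoukFrom f (suc k) (q * suc k)) acc ≡ (L , L))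
tchoukFrom-lastNonZero (suc f) k q@(suc _) 0<q q≤1+f p
  rewrite tchoukFrom-suc f (suc k) (q * suc k) {{m*n≢0 q (suc k)}}
  with q * suc k / suc (suc k) in quotient | alistPair-next-excess p 0<q
... | zero | p′ = suc k , (suc (suc k) , p′ , ≤-refl) , last
  where
  last : ∀ acc → lastNonZero (suc k) (q * suc k % suc (suc k) ∷ tchoukFrom f (suc (suc k)) 0) acc ≡ (suc k , suc k)
  last acc rewrite m*n/[1+n]≡0⇒m*n%[1+n]≡n q (suc k) 0<q quotient | tchoukFrom-zero f (suc (suc k)) = refl
... | suc q′ | p′
  with tchoukFrom-lastNonZero f (suc k) (suc q′) (s≤s z≤n)
         (≤-pred (≤-trans (subst (_< q) quotient (m*n/[1+n]<m q (suc k))) q≤1+f)) p′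
... | L , sr , last = L , sr , λ acc →
  let acc′ , next = lastNonZero-∷ (suc k) (q * suc k % suc (suc k)) _ acc in trans next (last acc′)

corollary3p5 : (n : ℕ) → 2 ≤ n →
    Σ ℕ (λ s → IsSr n s × (s ∸ 1 ≡ lengthC (Tchouk (n ∸ 1)))
                        × (lengthC (Tchouk (n ∸ 1)) ≡ finalC (Tchouk (n ∸ 1))))
corollary3p5 (suc m@(suc _)) (s≤s (s≤s z≤n))
  with tchoukFrom-lastNonZero (suc m) 0 m (s≤s z≤n) (n≤1+n m) (subst (AlistPair (suc m) 1) (+-comm 1 m) start)
... | L , sr , last = suc L , sr , sym (cong proj₁ scan) , trans (cong proj₁ scan) (sym (cong proj₂ scan))
  where
  scan : (lengthC (Tchouk m) , finalC (Tchouk m)) ≡ (L , L)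
  scan = trans (lengthC-finalC (Tchouk m))
               (subst (λ r → lastNonZero 1 (tchoukFrom (suc m) 1 r) (0 , 0) ≡ (L , L)) (*-identityʳ m) (last (0 , 0)))
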